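{- Let $n\ge 6$ and, for $q\in\{1,2\}$, let $L_q=\{\{i,i\oplus q\}:1\le i\le n\}\subseteq V(F_2(C_n))$. Then the subgraph of $F_2(C_n)$ induced by $L_1\cup L_2$ is isomorphic to the cycle $C_{2n}$.
   Context: $C_n$ is the cycle with vertex set $\{1,\dots,n\}$ and edges $\{i,i+1\}$ ($1\le i\le n-1$) and $\{1,n\}$. The $2$-token graph $F_2(C_n)$ has as vertices the $2$-element subsets of $\{1,\dots,n\}$, two being adjacent iff their symmetric difference is an edge of $C_n$. Here $i\oplus j$ denotes $(i+j)\bmod n$ with representatives $1,\dots,n$. -}

module Defs where

open import Data.Nat using (ℕ; suc; _<_; _%_; _+_; NonZero)
open import Data.Fin using (Fin; toℕ)
open import Data.Product using (Σ; _×_; _,_; ∃)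
open import Data.Sum using (_⊎_)
open import Relation.Binary.PropositionalEquality using (_≡_)
open import Relation.Nullary using (¬_)

-- Vertices of the cycle C_n are encoded as Fin n, vertex k ↔ label k+1
-- (labels 1..n of the paper).  For n ≥ 3 these are exactly the edges {i,i+1}, {1,n}.
CycleAdj : (n : ℕ) → .{{_ : NonZero n}} → Fin n → Fin n → Set
CycleAdj n a b = (toℕ b ≡ (toℕ a + 1) % n) ⊎ (toℕ a ≡ (toℕ b + 1) % n)

-- 2-element subsets of {0..n-1}: ordered pairs (i , j) with i < j.
Pair : ℕ → Set
Pair n = Σ (Fin n) λ i → Σ (Fin n) λ j → toℕ i < toℕ j

_∈P_ : ∀ {n} → Fin n → Pair n → Set
x ∈P (i , j , _) = (x ≡ i) ⊎ (x ≡ j)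

_∈△_,_ : ∀ {n} → Fin n → Pair n → Pair n → Set
x ∈△ A , B = ((x ∈P A) × ¬ (x ∈P B)) ⊎ ((x ∈P B) × ¬ (x ∈P A))

TokenAdj : (n : ℕ) → .{{_ : NonZero n}} → Pair n → Pair n → Set
TokenAdj n A B = Σ (Fin n) λ a → Σ (Fin n) λ b →
  CycleAdj n a b × (∀ x → (x ∈△ A , B → (x ≡ a) ⊎ (x ≡ b))
                          × ((x ≡ a) ⊎ (x ≡ b) → x ∈△ A , B))

IsSet2 : ∀ {n} → Pair n → Fin n → Fin n → Set
IsSet2 A u v = ∀ x → (x ∈P A → (x ≡ u) ⊎ (x ≡ v)) × ((x ≡ u) ⊎ (x ≡ v) → x ∈P A)

-- i ⊕ q on 0-indexed vertices: (i + q) mod n (matches the paper's ⊕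
-- on labels 1..n under the shift k ↔ k+1).
_⊕[_]_ : ∀ {n} → Fin n → .{{_ : NonZero n}} → ℕ → ℕ
_⊕[_]_ {n} i q = (toℕ i + q) % n

InL : (n : ℕ) → .{{_ : NonZero n}} → ℕ → Pair n → Set
InL n q A = Σ (Fin n) λ i → Σ (Fin n) λ j → (toℕ j ≡ (toℕ i + q) % n) × IsSet2 A i j

LVert : (n : ℕ) → .{{_ : NonZero n}} → Set
LVert n = Σ (Pair n) λ A → InL n 1 A ⊎ InL n 2 A

-- Graph isomorphism between the induced subgraph on L_1 ∪ L_2 and C_{2n}:
-- a bijection f (up to ≡ on the underlying pair) preserving and reflecting adjacency.
record IsoToCycle (n : ℕ) .{{nz : NonZero n}} .{{nz2 : NonZero (n + n)}} : Set where
  field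
    to      : LVert n → Fin (n + n)
    from    : Fin (n + n) → LVert n
    to-from : ∀ k → to (from k) ≡ k
    from-to : ∀ v → Σ.proj₁ (from (to v)) ≡ Σ.proj₁ v
    adj-to  : ∀ v w → TokenAdj n (Σ.proj₁ v) (Σ.proj₁ w) → CycleAdj (n + n) (to v) (to w)
    adj-from : ∀ v w → CycleAdj (n + n) (to v) (to w) → TokenAdj n (Σ.proj₁ v) (Σ.proj₁ w)

-- Index L₁ ∪ L₂ by Fin n × Fin 2, with (i , q) standing for {i , i ⊕ (q + 1)}, and send (i , q) to 2i + q.
-- Two 2-sets are adjacent in F₂(C_n) iff they share one element and their other elements are adjacent in
-- C_n. Writing all elements as iterates of the rotation x ↦ x ⊕ 1 from one base point, adjacency between
-- two index sets reduces to equations x ⊕ j = x ⊕ k with j, k ≤ 5, which for n ≥ 6 force j = k. What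
-- survives is {i, i⊕1} ~ {i, i⊕2} ~ {i⊕1, i⊕2}, i.e. (i , 0) ~ (i , 1) ~ (i ⊕ 1 , 0): the successor
-- relation of C_{2n} transported along 2i + q.
module Submission where

open import Defs
open import Data.Nat using (ℕ; zero; suc; _+_; _*_; _∸_; _<_; _≤_; _<?_; NonZero; >-nonZero)
import Data.Nat as ℕ
open import Data.Nat.Properties
  using (+-cancelˡ-≡; +-comm; +-suc; +-identityʳ; *-comm; m*n≢0; <-cmp; <-irrefl; <-asym; <-irrelevant;
         ≤-<-trans; <-≤-trans; m<n⇒0<n∸m; m∸n≤m; m∸n+n≡m; <⇒≤)
open import Data.Nat.DivMod
  using (_%_; _/_; _mod_; m≡m%n+[m/n]*n; m<n⇒m%n≡m; %-distribˡ-+; m%n%n≡m%n; %-congˡ; %-congʳ; m%n*o≡m*o%[n*o])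
open import Data.Nat.Divisibility using (divides; >⇒∤)
open import Data.Nat.Tactic.RingSolver using (solve-∀)
open import Data.Fin using (Fin; toℕ; cast; combine; remQuot)
open import Data.Fin.Patterns using (0F; 1F)
open import Data.Fin.Properties
  using (_≟_; toℕ-fromℕ<; toℕ-injective; toℕ<n; toℕ-cast; cast-involutive;
         toℕ-combine; remQuot-combine; combine-remQuot)
open import Data.Product using (∃; ∃₂; _×_; _,_; proj₁; proj₂; uncurry)
open import Data.Sum using (_⊎_; inj₁; inj₂; [_,_]′)
import Data.Sum as Sum
open import Data.Empty using (⊥; ⊥-elim)
open import Function using (id; _∘_; _⇔_; mk⇔; Equivalence)
open import Relation.Nullary using (¬_; Dec; yes; no; contradiction)
open import Relation.Nullary.Decidable using (True; False; toWitness; toWitnessFalse; _⊎-dec_)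
open import Relation.Binary.PropositionalEquality using (_≡_; _≢_; refl; sym; trans; cong; subst; module ≡-Reasoning)
open import Relation.Binary.Definitions using (tri<; tri≈; tri>)

[m+k]%n≢m : ∀ m {k n} .⦃ _ : NonZero n ⦄ → 0 < k → k < n → (m + k) % n ≢ m
[m+k]%n≢m m {k} {n} 0<k k<n [m+k]%n≡m = >⇒∤ ⦃ >-nonZero 0<k ⦄ k<n (divides ((m + k) / n) k≡q*n)
  where
  k≡q*n : k ≡ (m + k) / n * n
  k≡q*n = +-cancelˡ-≡ m _ _ (trans (m≡m%n+[m/n]*n (m + k) n) (cong (_+ (m + k) / n * n) [m+k]%n≡m))

[m%n+k]%n≡[m+k]%n : ∀ m k n .⦃ _ : NonZero n ⦄ → (m % n + k) % n ≡ (m + k) % n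
[m%n+k]%n≡[m+k]%n m k n = begin
  (m % n + k) % n            ≡⟨ %-distribˡ-+ (m % n) k n ⟩
  (m % n % n + k % n) % n    ≡⟨ cong (λ r → (r + k % n) % n) (m%n%n≡m%n m n) ⟩
  (m % n + k % n) % n        ≡⟨ %-distribˡ-+ m k n ⟨
  (m + k) % n                ∎
  where open ≡-Reasoning

module Rotation (n : ℕ) .⦃ _ : NonZero n ⦄ where

  rot : Fin n → Fin n
  rot x = (toℕ x + 1) mod n

  toℕ-rot : ∀ x → toℕ (rot x) ≡ (toℕ x + 1) % n
  toℕ-rot x = toℕ-fromℕ< _

  rot^ : ℕ → Fin n → Fin n
  rot^ zero    x = x
  rot^ (suc k) x = rot (rot^ k x)

  toℕ-rot^ : ∀ k x → toℕ (rot^ k x) ≡ (toℕ x + k) % n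
  toℕ-rot^ zero    x = sym (trans (cong (_% n) (+-identityʳ (toℕ x))) (m<n⇒m%n≡m (toℕ<n x)))
  toℕ-rot^ (suc k) x = begin
    toℕ (rot (rot^ k x))         ≡⟨ toℕ-rot (rot^ k x) ⟩
    (toℕ (rot^ k x) + 1) % n     ≡⟨ cong (λ m → (m + 1) % n) (toℕ-rot^ k x) ⟩
    ((toℕ x + k) % n + 1) % n    ≡⟨ [m%n+k]%n≡[m+k]%n (toℕ x + k) 1 n ⟩
    (toℕ x + k + 1) % n          ≡⟨ cong (_% n) (trans (+-comm (toℕ x + k) 1) (sym (+-suc (toℕ x) k))) ⟩
    (toℕ x + suc k) % n          ∎
    where open ≡-Reasoning

  rot^-+ : ∀ d k x → rot^ (d + k) x ≡ rot^ d (rot^ k x)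
  rot^-+ zero    k x = refl
  rot^-+ (suc d) k x = cong rot (rot^-+ d k x)

  rot^-fixedPointFree : ∀ {d} x → 0 < d → d < n → rot^ d x ≢ x
  rot^-fixedPointFree {d} x 0<d d<n rot^dx≡x =
    [m+k]%n≢m (toℕ x) 0<d d<n (trans (sym (toℕ-rot^ d x)) (cong toℕ rot^dx≡x))

  rot^-injective-< : ∀ {j k} x → j < k → k < n → rot^ j x ≢ rot^ k x
  rot^-injective-< {j} {k} x j<k k<n rot^jx≡rot^kx =
    rot^-fixedPointFree (rot^ j x) (m<n⇒0<n∸m j<k) (≤-<-trans (m∸n≤m k j) k<n) (begin
    rot^ (k ∸ j) (rot^ j x) ≡⟨ sym (rot^-+ (k ∸ j) j x) ⟩
    rot^ (k ∸ j + j) x      ≡⟨ cong (λ m → rot^ m x) (m∸n+n≡m (<⇒≤ j<k)) ⟩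
    rot^ k x                ≡⟨ sym rot^jx≡rot^kx ⟩
    rot^ j x                ∎)
    where open ≡-Reasoning

  rot^-fromToℕ : ∀ k x {y} → toℕ y ≡ (toℕ x + k) % n → y ≡ rot^ k x
  rot^-fromToℕ k x y≡x+k = toℕ-injective (trans y≡x+k (sym (toℕ-rot^ k x)))

  rot^-injective : ∀ {j k} x → j < n → k < n → rot^ j x ≡ rot^ k x → j ≡ k
  rot^-injective {j} {k} x j<n k<n rot^jx≡rot^kx with <-cmp j k
  ... | tri< j<k _ _ = contradiction rot^jx≡rot^kx (rot^-injective-< x j<k k<n)
  ... | tri≈ _ j≡k _ = j≡k
  ... | tri> _ _ k<j = contradiction (sym rot^jx≡rot^kx) (rot^-injective-< x k<j j<n)

  cycleAdj⇔rot : ∀ {x y} → CycleAdj n x y ⇔ (y ≡ rot x ⊎ x ≡ rot y)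
  cycleAdj⇔rot {x} {y} = mk⇔ to from
    where
    to : CycleAdj n x y → y ≡ rot x ⊎ x ≡ rot y
    to (inj₁ e) = inj₁ (toℕ-injective (trans e (sym (toℕ-rot x))))
    to (inj₂ e) = inj₂ (toℕ-injective (trans e (sym (toℕ-rot y))))
    from : y ≡ rot x ⊎ x ≡ rot y → CycleAdj n x y
    from (inj₁ refl) = inj₁ (toℕ-rot x)
    from (inj₂ refl) = inj₂ (toℕ-rot y)

private variable
  n : ℕ
  A B : Pair n
  a b x y z : Fin n

-- Records wrapping the predicates of Defs, so that the sets and their
-- enumerating elements can be inferred from a proof.
record _≐⟨_,_⟩ (A : Pair n) (x y : Fin n) : Set where
  constructor enum
  field enumerates : IsSet2 A x y

open _≐⟨_,_⟩

record _△_≐⟨_,_⟩ (A B : Pair n) (a b : Fin n) : Set where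
  constructor enum△
  field enumerates△ : ∀ z → (z ∈△ A , B → z ≡ a ⊎ z ≡ b) × (z ≡ a ⊎ z ≡ b → z ∈△ A , B)

open _△_≐⟨_,_⟩

∈-≐⁻ : A ≐⟨ x , y ⟩ → z ∈P A → z ≡ x ⊎ z ≡ y
∈-≐⁻ A≐ z∈A = proj₁ (enumerates A≐ _) z∈A

∈-≐⁺ : A ≐⟨ x , y ⟩ → z ≡ x ⊎ z ≡ y → z ∈P A
∈-≐⁺ A≐ z≡ = proj₂ (enumerates A≐ _) z≡

∉-≐ : A ≐⟨ x , y ⟩ → z ≢ x → z ≢ y → ¬ z ∈P A
∉-≐ A≐ z≢x z≢y z∈A = [ z≢x , z≢y ]′ (∈-≐⁻ A≐ z∈A)

_∈P?_ : (z : Fin n) (A : Pair n) → Dec (z ∈P A)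
z ∈P? (i , j , _) = (z ≟ i) ⊎-dec (z ≟ j)

≐-self : ∀ {i j : Fin n} (i<j : toℕ i < toℕ j) → (i , j , i<j) ≐⟨ i , j ⟩
≐-self _ = enum λ _ → id , id

≐-swap : A ≐⟨ x , y ⟩ → A ≐⟨ y , x ⟩
≐-swap A≐ = enum λ _ → Sum.swap ∘ ∈-≐⁻ A≐ , ∈-≐⁺ A≐ ∘ Sum.swap

≐-distinct : A ≐⟨ x , y ⟩ → x ≢ y
≐-distinct {A = i , j , i<j} {x = x} A≐ refl =
  <-irrefl (cong toℕ (trans (≡x (inj₁ refl)) (sym (≡x (inj₂ refl))))) i<j
  where
  ≡x : z ∈P (i , j , i<j) → z ≡ x
  ≡x z∈A = [ id , id ]′ (∈-≐⁻ A≐ z∈A)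

∈⇒≐ : z ∈P A → ∃ λ w → A ≐⟨ w , z ⟩
∈⇒≐ {A = i , j , i<j} (inj₁ refl) = j , ≐-swap (≐-self i<j)
∈⇒≐ {A = i , j , i<j} (inj₂ refl) = i , ≐-self i<j

⟨_,_⟩≈⟨_,_⟩ : Fin n → Fin n → Fin n → Fin n → Set
⟨ x , y ⟩≈⟨ u , v ⟩ = (x ≡ u × y ≡ v) ⊎ (x ≡ v × y ≡ u)

≐-agree : ∀ {u v} → A ≐⟨ x , y ⟩ → A ≐⟨ u , v ⟩ → ⟨ x , y ⟩≈⟨ u , v ⟩
≐-agree A≐xy A≐uv with ∈-≐⁻ A≐uv (∈-≐⁺ A≐xy (inj₁ refl)) | ∈-≐⁻ A≐uv (∈-≐⁺ A≐xy (inj₂ refl))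
... | inj₁ x≡u | inj₂ y≡v = inj₁ (x≡u , y≡v)
... | inj₂ x≡v | inj₁ y≡u = inj₂ (x≡v , y≡u)
... | inj₁ x≡u | inj₁ y≡u = contradiction (trans x≡u (sym y≡u)) (≐-distinct A≐xy)
... | inj₂ x≡v | inj₂ y≡v = contradiction (trans x≡v (sym y≡v)) (≐-distinct A≐xy)

≐-unique : A ≐⟨ x , y ⟩ → B ≐⟨ x , y ⟩ → A ≡ B
≐-unique {A = i , j , i<j} {B = i′ , j′ , i′<j′} A≐ B≐ with ≐-agree (≐-self i<j) A≐i′j′
  where
  A≐i′j′ : (i , j , i<j) ≐⟨ i′ , j′ ⟩
  A≐i′j′ = enum λ _ → ∈-≐⁻ (≐-self i′<j′) ∘ ∈-≐⁺ B≐ ∘ ∈-≐⁻ A≐ , ∈-≐⁺ A≐ ∘ ∈-≐⁻ B≐ ∘ ∈-≐⁺ (≐-self i′<j′)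
... | inj₁ (refl , refl) = cong (λ i<j → i , j , i<j) (<-irrelevant i<j i′<j′)
... | inj₂ (refl , refl) = ⊥-elim (<-asym i<j i′<j′)

pair : (x y : Fin n) → x ≢ y → Pair n
pair x y x≢y with <-cmp (toℕ x) (toℕ y)
... | tri< x<y _ _ = x , y , x<y
... | tri≈ _ x≡y _ = ⊥-elim (x≢y (toℕ-injective x≡y))
... | tri> _ _ y<x = y , x , y<x

pair-≐ : (x y : Fin n) (x≢y : x ≢ y) → pair x y x≢y ≐⟨ x , y ⟩
pair-≐ x y x≢y with <-cmp (toℕ x) (toℕ y)
... | tri< x<y _ _ = ≐-self x<y
... | tri≈ _ x≡y _ = ⊥-elim (x≢y (toℕ-injective x≡y))
... | tri> _ _ y<x = ≐-swap (≐-self y<x)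

∈-△⁻ : A △ B ≐⟨ a , b ⟩ → z ∈△ A , B → z ≡ a ⊎ z ≡ b
∈-△⁻ A△B = proj₁ (enumerates△ A△B _)

∈-△⁺ : A △ B ≐⟨ a , b ⟩ → z ≡ a ⊎ z ≡ b → z ∈△ A , B
∈-△⁺ A△B = proj₂ (enumerates△ A△B _)

△-comm : A △ B ≐⟨ a , b ⟩ → B △ A ≐⟨ a , b ⟩
△-comm A△B = enum△ λ _ → ∈-△⁻ A△B ∘ Sum.swap , Sum.swap ∘ ∈-△⁺ A△B

△-swap : A △ B ≐⟨ a , b ⟩ → A △ B ≐⟨ b , a ⟩
△-swap A△B = enum△ λ _ → Sum.swap ∘ ∈-△⁻ A△B , ∈-△⁺ A△B ∘ Sum.swap

shared⇒△ : ∀ {A B : Pair n} {c a b} → A ≐⟨ c , a ⟩ → B ≐⟨ c , b ⟩ → a ≢ b → A △ B ≐⟨ a , b ⟩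
shared⇒△ {A = A} {B} {c} {a} {b} A≐ B≐ a≢b = enum△ λ z → to , from
  where
  to : z ∈△ A , B → z ≡ a ⊎ z ≡ b
  to (inj₁ (z∈A , z∉B)) = inj₁ ([ (λ z≡c → contradiction (∈-≐⁺ B≐ (inj₁ z≡c)) z∉B) , id ]′ (∈-≐⁻ A≐ z∈A))
  to (inj₂ (z∈B , z∉A)) = inj₂ ([ (λ z≡c → contradiction (∈-≐⁺ A≐ (inj₁ z≡c)) z∉A) , id ]′ (∈-≐⁻ B≐ z∈B))
  from : z ≡ a ⊎ z ≡ b → z ∈△ A , B
  from (inj₁ refl) = inj₁ (∈-≐⁺ A≐ (inj₂ refl) , ∉-≐ B≐ (≐-distinct A≐ ∘ sym) a≢b)
  from (inj₂ refl) = inj₂ (∈-≐⁺ B≐ (inj₂ refl) , ∉-≐ A≐ (≐-distinct B≐ ∘ sym) (a≢b ∘ sym))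

△-moved : A △ B ≐⟨ a , b ⟩ → a ∈P A → b ∈P B → ¬ b ∈P A → ∃ λ c → A ≐⟨ c , a ⟩ × B ≐⟨ c , b ⟩
△-moved {A = A} {B = B} {b = b} A△B a∈A b∈B b∉A with ∈⇒≐ {A = A} a∈A
... | w , A≐wa with w ∈P? B
...   | yes w∈B = w , A≐wa , B≐wb (∈⇒≐ {A = B} w∈B)
  where
  B≐wb : (∃ λ v → B ≐⟨ v , w ⟩) → B ≐⟨ w , b ⟩
  B≐wb (v , B≐vw) with ∈-≐⁻ B≐vw b∈B
  ... | inj₁ refl = ≐-swap B≐vw
  ... | inj₂ b≡w  = contradiction (∈-≐⁺ A≐wa (inj₁ b≡w)) b∉A
...   | no w∉B with ∈-△⁻ A△B (inj₁ (∈-≐⁺ A≐wa (inj₁ refl) , w∉B))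
...     | inj₁ w≡a = contradiction w≡a (≐-distinct A≐wa)
...     | inj₂ w≡b = contradiction (∈-≐⁺ A≐wa (inj₁ (sym w≡b))) b∉A

△-¬oneSided : a ≢ b → A △ B ≐⟨ a , b ⟩ → a ∈P A → b ∈P A → ¬ a ∈P B → ¬ b ∈P B → ⊥
△-¬oneSided {a = a} {b} {A = A} {B = i′ , j′ , i′<j′} a≢b A△B a∈A b∈A a∉B b∉B =
  [ (λ { refl → a∉B (inj₁ refl) }) , (λ { refl → b∉B (inj₁ refl) }) ]′ (B⊆ab i′ (inj₁ refl))
  where
  A≐ba : A ≐⟨ b , a ⟩
  A≐ba with ∈⇒≐ {A = A} a∈A
  ... | w , A≐wa with ∈-≐⁻ A≐wa b∈A
  ...   | inj₁ refl = A≐wa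
  ...   | inj₂ b≡a  = contradiction (sym b≡a) a≢b
  B⊆ab : ∀ z → z ∈P (i′ , j′ , i′<j′) → z ≡ a ⊎ z ≡ b
  B⊆ab z z∈B with z ∈P? A
  ... | yes z∈A = Sum.swap (∈-≐⁻ A≐ba z∈A)
  ... | no z∉A  = ∈-△⁻ A△B (inj₂ (z∈B , z∉A))

△⇒shared : a ≢ b → A △ B ≐⟨ a , b ⟩ →
           (∃ λ c → A ≐⟨ c , a ⟩ × B ≐⟨ c , b ⟩) ⊎ (∃ λ c → A ≐⟨ c , b ⟩ × B ≐⟨ c , a ⟩)
△⇒shared a≢b A△B with ∈-△⁺ A△B (inj₁ refl) | ∈-△⁺ A△B (inj₂ refl)
... | inj₁ (a∈A , _)   | inj₂ (b∈B , b∉A) = inj₁ (△-moved A△B a∈A b∈B b∉A)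
... | inj₂ (a∈B , a∉A) | inj₁ (b∈A , _)   = inj₂ (△-moved (△-swap A△B) b∈A a∈B a∉A)
... | inj₁ (a∈A , a∉B) | inj₁ (b∈A , b∉B) = ⊥-elim (△-¬oneSided a≢b A△B a∈A b∈A a∉B b∉B)
... | inj₂ (a∈B , a∉A) | inj₂ (b∈B , b∉A) = ⊥-elim (△-¬oneSided a≢b (△-comm A△B) a∈B b∈B a∉A b∉A)

module Interleaving (n : ℕ) .⦃ _ : NonZero n ⦄ .⦃ _ : NonZero (n + n) ⦄ where

  open Rotation n using (rot; toℕ-rot)
  private module R = Rotation (n + n)

  next : Fin n × Fin 2 → Fin n × Fin 2
  next (i , 0F) = i , 1F
  next (i , 1F) = rot i , 0F

  Consecutive : Fin n × Fin 2 → Fin n × Fin 2 → Set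
  Consecutive p p′ = p′ ≡ next p ⊎ p ≡ next p′

  n*2≡n+n : n * 2 ≡ n + n
  n*2≡n+n = trans (*-comm n 2) (cong (n +_) (+-identityʳ n))

  code : Fin n × Fin 2 → Fin (n + n)
  code p = cast n*2≡n+n (uncurry combine p)

  decode : Fin (n + n) → Fin n × Fin 2
  decode k = remQuot 2 (cast (sym n*2≡n+n) k)

  decode-code : ∀ p → decode (code p) ≡ p
  decode-code (i , q) =
    trans (cong (remQuot 2) (cast-involutive (sym n*2≡n+n) n*2≡n+n (combine i q))) (remQuot-combine i q)

  code-decode : ∀ k → code (decode k) ≡ k
  code-decode k =
    trans (cong (cast n*2≡n+n) (combine-remQuot {n} 2 _)) (cast-involutive n*2≡n+n (sym n*2≡n+n) k)

  code-injective : ∀ {p p′} → code p ≡ code p′ → p ≡ p′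
  code-injective {p} {p′} e = trans (sym (decode-code p)) (trans (cong decode e) (decode-code p′))

  toℕ-code : ∀ i q → toℕ (code (i , q)) ≡ 2 * toℕ i + toℕ q
  toℕ-code i q = trans (toℕ-cast _ (combine i q)) (toℕ-combine i q)

  code-next : ∀ p → code (next p) ≡ R.rot (code p)
  code-next (i , 0F) = toℕ-injective (begin
    toℕ (code (i , 1F))                 ≡⟨ m<n⇒m%n≡m (toℕ<n (code (i , 1F))) ⟨
    toℕ (code (i , 1F)) % (n + n)       ≡⟨ %-congˡ (trans (toℕ-code i 1F) (cong (_+ 1) 2i≡code)) ⟩
    (toℕ (code (i , 0F)) + 1) % (n + n) ≡⟨ R.toℕ-rot (code (i , 0F)) ⟨
    toℕ (R.rot (code (i , 0F)))         ∎)
    where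
    open ≡-Reasoning
    2i≡code : 2 * toℕ i ≡ toℕ (code (i , 0F))
    2i≡code = sym (trans (toℕ-code i 0F) (+-identityʳ _))
  -- The wrap-around from (n − 1 , 1) to (0 , 0) is absorbed by (m % n) * 2 ≡ m * 2 % (n * 2).
  code-next (i , 1F) = toℕ-injective (begin
    toℕ (code (rot i , 0F))             ≡⟨ trans (toℕ-code (rot i) 0F) (2x+0≡x*2 (toℕ (rot i))) ⟩
    toℕ (rot i) * 2                     ≡⟨ cong (_* 2) (toℕ-rot i) ⟩
    (toℕ i + 1) % n * 2                 ≡⟨ m%n*o≡m*o%[n*o] (toℕ i + 1) n 2 ⟩
    (toℕ i + 1) * 2 % (n * 2)           ≡⟨ %-congʳ n*2≡n+n ⟩
    (toℕ i + 1) * 2 % (n + n)           ≡⟨ %-congˡ ([x+1]*2≡2x+0+2 (toℕ i)) ⟩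
    (2 * toℕ i + 0 + 2) % (n + n)       ≡⟨ cong (λ m → (m + 2) % (n + n)) (toℕ-code i 0F) ⟨
    (toℕ (code (i , 0F)) + 2) % (n + n) ≡⟨ R.toℕ-rot^ 2 (code (i , 0F)) ⟨
    toℕ (R.rot^ 2 (code (i , 0F)))      ≡⟨ cong (toℕ ∘ R.rot) (code-next (i , 0F)) ⟨
    toℕ (R.rot (code (i , 1F)))         ∎)
    where
    open ≡-Reasoning
    instance
      n*2-nonZero : NonZero (n * 2)
      n*2-nonZero = m*n≢0 n 2
    2x+0≡x*2 : ∀ x → 2 * x + 0 ≡ x * 2
    2x+0≡x*2 = solve-∀
    [x+1]*2≡2x+0+2 : ∀ x → (x + 1) * 2 ≡ 2 * x + 0 + 2
    [x+1]*2≡2x+0+2 = solve-∀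

  cycleAdj⇔consecutive : ∀ p p′ → CycleAdj (n + n) (code p) (code p′) ⇔ Consecutive p p′
  cycleAdj⇔consecutive p p′ = mk⇔
    (Sum.map (λ e → code-injective (trans e (sym (code-next p))))
             (λ e → code-injective (trans e (sym (code-next p′)))) ∘ Equivalence.to R.cycleAdj⇔rot)
    (Equivalence.from R.cycleAdj⇔rot ∘ Sum.map (λ { refl → code-next p }) (λ { refl → code-next p′ }))

module Main (n : ℕ) (6≤n : 6 ≤ n) .⦃ _ : NonZero n ⦄ .⦃ _ : NonZero (n + n) ⦄ where

  open Rotation n
  open Interleaving n

  rot^-distinct : ∀ j k x {j≢k : False (j ℕ.≟ k)} {j<6 : True (j <? 6)} {k<6 : True (k <? 6)} →
                  rot^ j x ≢ rot^ k x
  rot^-distinct j k x {j≢k} {j<6} {k<6} =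
    toWitnessFalse j≢k ∘ rot^-injective x (<-≤-trans (toWitness j<6) 6≤n) (<-≤-trans (toWitness k<6) 6≤n)

  partner : Fin n × Fin 2 → Fin n
  partner (i , q) = rot^ (suc (toℕ q)) i

  _≐⟦_⟧ : Pair n → Fin n × Fin 2 → Set
  A ≐⟦ p ⟧ = A ≐⟨ proj₁ p , partner p ⟩

  vertex : Fin n × Fin 2 → LVert n
  vertex (i , 0F) =
    pair i (rot i) (rot^-distinct 0 1 i) , inj₁ (i , rot i , toℕ-rot^ 1 i , enumerates (pair-≐ i (rot i) _))
  vertex (i , 1F) =
    pair i (rot^ 2 i) (rot^-distinct 0 2 i) , inj₂ (i , rot^ 2 i , toℕ-rot^ 2 i , enumerates (pair-≐ i (rot^ 2 i) _))

  vertex-≐ : ∀ p → proj₁ (vertex p) ≐⟦ p ⟧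
  vertex-≐ (i , 0F) = pair-≐ i (rot i) _
  vertex-≐ (i , 1F) = pair-≐ i (rot^ 2 i) _

  index : LVert n → Fin n × Fin 2
  index (_ , inj₁ (i , _)) = i , 0F
  index (_ , inj₂ (i , _)) = i , 1F

  index-vertex : ∀ p → index (vertex p) ≡ p
  index-vertex (i , 0F) = refl
  index-vertex (i , 1F) = refl

  index-≐ : ∀ v → proj₁ v ≐⟦ index v ⟧
  index-≐ (A , inj₁ (i , j , j≡i+1 , A≐ij)) = subst (A ≐⟨ i ,_⟩) (rot^-fromToℕ 1 i j≡i+1) (enum A≐ij)
  index-≐ (A , inj₂ (i , j , j≡i+2 , A≐ij)) = subst (A ≐⟨ i ,_⟩) (rot^-fromToℕ 2 i j≡i+2) (enum A≐ij)

  TokenStep : Pair n → Pair n → Set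
  TokenStep A B = ∃₂ λ c a → A ≐⟨ c , a ⟩ × B ≐⟨ c , rot a ⟩

  tokenAdj⇒step : ∀ {A B} → TokenAdj n A B → TokenStep A B ⊎ TokenStep B A
  tokenAdj⇒step (a , b , a~b , A△B) with Equivalence.to cycleAdj⇔rot a~b
  ... | inj₁ refl = [ (λ (c , A≐ , B≐) → inj₁ (c , a , A≐ , B≐)) , (λ (c , A≐ , B≐) → inj₂ (c , a , B≐ , A≐)) ]′
                      (△⇒shared (rot^-distinct 0 1 a) (enum△ A△B))
  ... | inj₂ refl = [ (λ (c , A≐ , B≐) → inj₂ (c , b , B≐ , A≐)) , (λ (c , A≐ , B≐) → inj₁ (c , b , A≐ , B≐)) ]′
                      (△⇒shared (rot^-distinct 1 0 b) (enum△ A△B))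

  step⇒tokenAdj : ∀ {A B} → TokenStep A B ⊎ TokenStep B A → TokenAdj n A B
  step⇒tokenAdj (inj₁ (c , a , A≐ , B≐)) =
    a , rot a , Equivalence.from cycleAdj⇔rot (inj₁ refl) , enumerates△ (shared⇒△ A≐ B≐ (rot^-distinct 0 1 a))
  step⇒tokenAdj (inj₂ (c , a , B≐ , A≐)) =
    rot a , a , Equivalence.from cycleAdj⇔rot (inj₂ refl) , enumerates△ (shared⇒△ A≐ B≐ (rot^-distinct 1 0 a))

  -- Matching the shared token c expresses both vertices through the single base point i; what remains
  -- is either an equation rot^ j i ≡ rot^ k i with j ≠ k ≤ 5, impossible since n ≥ 6, or p′ = next p.
  shift⇒next : ∀ p p′ {c a} → ⟨ proj₁ p , partner p ⟩≈⟨ c , a ⟩ → ⟨ proj₁ p′ , partner p′ ⟩≈⟨ c , rot a ⟩ →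
               p′ ≡ next p
  shift⇒next (i , 0F) (_ , 0F) (inj₁ (refl , refl)) (inj₁ (refl , e))    = ⊥-elim (rot^-distinct 1 2 i e)
  shift⇒next (i , 0F) (_ , 0F) (inj₁ (refl , refl)) (inj₂ (refl , e))    = ⊥-elim (rot^-distinct 3 0 i e)
  shift⇒next (i , 0F) (_ , 0F) (inj₂ (refl , refl)) (inj₁ (refl , e))    = ⊥-elim (rot^-distinct 2 1 i e)
  shift⇒next (i , 0F) (_ , 0F) (inj₂ (refl , refl)) (inj₂ (refl , e))    = ⊥-elim (rot^-distinct 2 1 i e)
  shift⇒next (i , 0F) (_ , 1F) (inj₁ (refl , refl)) (inj₁ (refl , refl)) = refl
  shift⇒next (i , 0F) (_ , 1F) (inj₁ (refl , refl)) (inj₂ (refl , e))    = ⊥-elim (rot^-distinct 4 0 i e)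
  shift⇒next (i , 0F) (_ , 1F) (inj₂ (refl , refl)) (inj₁ (refl , e))    = ⊥-elim (rot^-distinct 3 1 i e)
  shift⇒next (i , 0F) (_ , 1F) (inj₂ (refl , refl)) (inj₂ (refl , e))    = ⊥-elim (rot^-distinct 3 1 i e)
  shift⇒next (i , 1F) (_ , 0F) (inj₁ (refl , refl)) (inj₁ (refl , e))    = ⊥-elim (rot^-distinct 1 3 i e)
  shift⇒next (i , 1F) (_ , 0F) (inj₁ (refl , refl)) (inj₂ (refl , e))    = ⊥-elim (rot^-distinct 4 0 i e)
  shift⇒next (i , 1F) (_ , 0F) (inj₂ (refl , refl)) (inj₁ (refl , e))    = ⊥-elim (rot^-distinct 3 1 i e)
  shift⇒next (i , 1F) (_ , 0F) (inj₂ (refl , refl)) (inj₂ (refl , refl)) = refl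
  shift⇒next (i , 1F) (_ , 1F) (inj₁ (refl , refl)) (inj₁ (refl , e))    = ⊥-elim (rot^-distinct 2 3 i e)
  shift⇒next (i , 1F) (_ , 1F) (inj₁ (refl , refl)) (inj₂ (refl , e))    = ⊥-elim (rot^-distinct 5 0 i e)
  shift⇒next (i , 1F) (_ , 1F) (inj₂ (refl , refl)) (inj₁ (refl , e))    = ⊥-elim (rot^-distinct 4 1 i e)
  shift⇒next (i , 1F) (_ , 1F) (inj₂ (refl , refl)) (inj₂ (refl , e))    = ⊥-elim (rot^-distinct 3 2 i e)

  step⇒next : ∀ p p′ {A B} → A ≐⟦ p ⟧ → B ≐⟦ p′ ⟧ → TokenStep A B → p′ ≡ next p
  step⇒next p p′ A≐ B≐ (c , a , A≐ca , B≐cb) = shift⇒next p p′ (≐-agree A≐ A≐ca) (≐-agree B≐ B≐cb)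

  next⇒step : ∀ p p′ {A B} → A ≐⟦ p ⟧ → B ≐⟦ p′ ⟧ → p′ ≡ next p → TokenStep A B
  next⇒step (i , 0F) _ A≐ B≐ refl = i , rot i , A≐ , B≐
  next⇒step (i , 1F) _ A≐ B≐ refl = rot^ 2 i , i , ≐-swap A≐ , ≐-swap B≐

  tokenAdj⇔consecutive : ∀ v w → TokenAdj n (proj₁ v) (proj₁ w) ⇔ Consecutive (index v) (index w)
  tokenAdj⇔consecutive v w = mk⇔
    (Sum.map (step⇒next _ _ (index-≐ v) (index-≐ w)) (step⇒next _ _ (index-≐ w) (index-≐ v)) ∘ tokenAdj⇒step)
    (step⇒tokenAdj ∘ Sum.map (next⇒step _ _ (index-≐ v) (index-≐ w)) (next⇒step _ _ (index-≐ w) (index-≐ v)))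

  iso : IsoToCycle n
  iso = record
    { to       = code ∘ index
    ; from     = vertex ∘ decode
    ; to-from  = λ k → trans (cong code (index-vertex (decode k))) (code-decode k)
    ; from-to  = λ v → trans (cong (proj₁ ∘ vertex) (decode-code (index v)))
                             (≐-unique (vertex-≐ (index v)) (index-≐ v))
    ; adj-to   = λ v w → Equivalence.from (cycleAdj⇔consecutive _ _) ∘ Equivalence.to (tokenAdj⇔consecutive v w)
    ; adj-from = λ v w → Equivalence.from (tokenAdj⇔consecutive v w) ∘ Equivalence.to (cycleAdj⇔consecutive _ _)
    }

mainTheorem6 : (n : ℕ) → 6 ≤ n → .{{nz : NonZero n}} → .{{nz2 : NonZero (n Data.Nat.+ n)}} → IsoToCycle n
mainTheorem6 n 6≤n = Main.iso n 6≤n
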